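{- Let $\mathbf{2}$ and $\mathbf{3}$ be the two-element and the three-element NM chains, respectively. Let $\mathbf{A}$ be a finite NM algebra and $\mathbf{p}$ a maximal prime filter of $\mathbf{A}$. Then the quotient $\mathbf{A}/\mathbf{p}$ is isomorphic either to $\mathbf{2}$ or to $\mathbf{3}$.
   Context: An NM algebra is an algebra $\langle A,\wedge,\vee,\odot,\to,\bot,\top\rangle$ such that $\langle A,\wedge,\vee,\bot,\top\rangle$ is a bounded lattice, $\langle A,\odot,\top\rangle$ is a commutative monoid, and: $x\odot y\le z$ iff $x\le y\to z$; $(x\to y)\vee(y\to x)=\top$; $\neg(x\odot y)\vee((x\wedge y)\to(x\odot y))=\top$; $\neg\neg x=x$, where $\neg x:=x\to\bot$. An NM chain is an NM algebra whose lattice order is total; $\mathbf{2}=\{0,1\}$ and $\mathbf{3}=\{0,\tfrac12,1\}$ with $\wedge=\min$, $\vee=\max$, $x\odot y=\min\{x,y\}$ if $x+y>1$ and $0$ otherwise, $x\to y=1$ if $x\le y$ and $\max\{1-x,y\}$ otherwise. A filter of $\mathbf{A}$ is a nonempty upward closed subset closed under $\odot$; it is prime if it is not all of $A$ and $x\vee y\in S$ implies $x\in S$ or $y\in S$. A maximal prime filter is a prime filter not properly contained in any other prime filter (equivalently, one generated by a minimal element among the idempotent join-irreducible elements of $\mathbf{A}$). The quotient $\mathbf{A}/\mathbf{p}$ is by the congruence $x\sim y$ iff $(x\to y)\odot(y\to x)\in\mathbf{p}$. -}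

module Defs where

open import Level using (0ℓ)
open import Data.Nat using (ℕ)
open import Data.Fin using (Fin)
open import Data.Product using (Σ; ∃; _×_; _,_)
open import Data.Sum using (_⊎_)
open import Relation.Nullary using (¬_)
open import Relation.Binary.PropositionalEquality using (_≡_)
open import Function.Bundles using (_↔_; _⇔_)

record NMSig : Set₁ where
  infixr 6 _∧_
  infixr 5 _∨_
  infixr 7 _⊙_
  infixr 4 _⇒_
  infix 3 _≤_
  field
    Carrier : Set
    _∧_ _∨_ _⊙_ _⇒_ : Carrier → Carrier → Carrier
    bot top : Carrier

  _≤_ : Carrier → Carrier → Set
  x ≤ y = x ∧ y ≡ x

  ¬' : Carrier → Carrier
  ¬' x = x ⇒ bot

record IsNMAlgebra (A : NMSig) : Set where
  open NMSig A
  field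
    ∧-assoc : ∀ x y z → (x ∧ y) ∧ z ≡ x ∧ (y ∧ z)
    ∨-assoc : ∀ x y z → (x ∨ y) ∨ z ≡ x ∨ (y ∨ z)
    ∧-comm  : ∀ x y → x ∧ y ≡ y ∧ x
    ∨-comm  : ∀ x y → x ∨ y ≡ y ∨ x
    ∧-absorb : ∀ x y → x ∧ (x ∨ y) ≡ x
    ∨-absorb : ∀ x y → x ∨ (x ∧ y) ≡ x
    bot-least : ∀ x → bot ≤ x
    top-greatest : ∀ x → x ≤ top
    ⊙-assoc : ∀ x y z → (x ⊙ y) ⊙ z ≡ x ⊙ (y ⊙ z)
    ⊙-comm  : ∀ x y → x ⊙ y ≡ y ⊙ x
    ⊙-identity : ∀ x → x ⊙ top ≡ x
    residuation : ∀ x y z → (x ⊙ y ≤ z) ⇔ (x ≤ (y ⇒ z))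
    prelinear : ∀ x y → (x ⇒ y) ∨ (y ⇒ x) ≡ top
    wnm : ∀ x y → ¬' (x ⊙ y) ∨ ((x ∧ y) ⇒ (x ⊙ y)) ≡ top
    involutive : ∀ x → ¬' (¬' x) ≡ x

Finite : Set → Set
Finite X = ∃ λ (n : ℕ) → X ↔ Fin n

module _ (A : NMSig) where
  open NMSig A

  record IsFilter (S : Carrier → Set) : Set where
    field
      nonempty : ∃ λ x → S x
      upclosed : ∀ x y → S x → x ≤ y → S y
      ⊙-closed : ∀ x y → S x → S y → S (x ⊙ y)

  record IsPrimeFilter (S : Carrier → Set) : Set where
    field
      filter : IsFilter S
      proper : ∃ λ x → ¬ S x
      prime  : ∀ x y → S (x ∨ y) → S x ⊎ S y

  record IsMaximalPrimeFilter (S : Carrier → Set) : Set₁ where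
    field
      primeF : IsPrimeFilter S
      maximal : ∀ (T : Carrier → Set) → IsPrimeFilter T →
                (∀ x → S x → T x) → (∀ x → T x → S x)

  _∼[_]_ : Carrier → (Carrier → Set) → Carrier → Set
  x ∼[ p ] y = p ((x ⇒ y) ⊙ (y ⇒ x))

-- A/p ≅ B, expressed via the quotient map: an isomorphism between the
-- quotient A/p and B is the same as a map f : A → B which is a
-- surjective homomorphism whose kernel is exactly ∼[p]
-- (f induces the bijective homomorphism [x] ↦ f x).

record QuotientIso (A : NMSig) (p : NMSig.Carrier A → Set) (B : NMSig) : Set where
  private
    module A = NMSig A
    module B = NMSig B
  field
    f : A.Carrier → B.Carrier
    kernel : ∀ x y → (f x ≡ f y) ⇔ (_∼[_]_ A x p y)
    surjective : ∀ b → ∃ λ x → f x ≡ b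
    pres-∧ : ∀ x y → f (x A.∧ y) ≡ f x B.∧ f y
    pres-∨ : ∀ x y → f (x A.∨ y) ≡ f x B.∨ f y
    pres-⊙ : ∀ x y → f (x A.⊙ y) ≡ f x B.⊙ f y
    pres-⇒ : ∀ x y → f (x A.⇒ y) ≡ (f x B.⇒ f y)
    pres-bot : f A.bot ≡ B.bot
    pres-top : f A.top ≡ B.top

data Two : Set where
  o₂ i₂ : Two

data Three : Set where
  o₃ h₃ i₃ : Three   -- 0, 1/2, 1

module Chain2 where
  min max mul imp : Two → Two → Two
  min o₂ _ = o₂
  min i₂ y = y
  max o₂ y = y
  max i₂ _ = i₂
  -- x ⊙ y = min x y if x + y > 1, else 0
  mul i₂ i₂ = i₂
  mul _  _  = o₂
  -- x → y = 1 if x ≤ y, else max (1 - x) y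
  imp i₂ o₂ = o₂
  imp _  _  = i₂

𝟐 : NMSig
𝟐 = record { Carrier = Two ; _∧_ = Chain2.min ; _∨_ = Chain2.max
           ; _⊙_ = Chain2.mul ; _⇒_ = Chain2.imp ; bot = o₂ ; top = i₂ }

module Chain3 where
  min max mul imp : Three → Three → Three
  min o₃ _  = o₃
  min h₃ o₃ = o₃
  min h₃ _  = h₃
  min i₃ y  = y
  max o₃ y  = y
  max h₃ i₃ = i₃
  max h₃ _  = h₃
  max i₃ _  = i₃
  -- x ⊙ y = min x y if x + y > 1, else 0
  mul h₃ i₃ = h₃
  mul i₃ h₃ = h₃
  mul i₃ i₃ = i₃
  mul _  _  = o₃
  -- x → y = 1 if x ≤ y, else max (1 - x) y
  imp h₃ o₃ = h₃
  imp i₃ o₃ = o₃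
  imp i₃ h₃ = h₃
  imp _  _  = i₃

𝟑 : NMSig
𝟑 = record { Carrier = Three ; _∧_ = Chain3.min ; _∨_ = Chain3.max
           ; _⊙_ = Chain3.mul ; _⇒_ = Chain3.imp ; bot = o₃ ; top = i₃ }

module Submission where

-- Let p be a maximal prime filter of an NM algebra A.  The argument does
-- not need A to be a chain; finiteness is only used at the very end.
--
--  * For every z the square e = z ⊙ z is idempotent (a consequence of the
--    WNM axiom), and if ¬ e ∉ p then {y | e ⇒ y ∈ p} is a prime filter
--    containing p and e.  Maximality forces it to equal p, so z ∈ p.
--  * Applied to z = x ∨ ¬ (x ⊙ x) this gives the dichotomy
--    x ∈ p  or  ¬ (x ⊙ x) ∈ p,  hence membership in p is decidable.
--  * Every x is therefore "upper" (x ∈ p), "lower" (¬ x ∈ p) or "middle"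
--    (neither), and any two middle elements x, y satisfy x ⇒ y ∈ p.
--  * Sending upper, middle, lower elements to 1, ½, 0 is a homomorphism
--    A → 𝟑 whose kernel is exactly the congruence of p.  If some element
--    is middle it is onto, giving A/p ≅ 𝟑; otherwise it lands in {0, 1}
--    and composing with the retraction 𝟑 → 𝟐 gives A/p ≅ 𝟐.
--  * Finiteness of A decides which of the two cases occurs.

open import Defs
open import Data.Sum using (_⊎_; inj₁; inj₂; [_,_])
open import Data.Product using (∃; _×_; _,_; proj₂)
open import Data.Empty using (⊥-elim)
open import Relation.Nullary using (¬_; Dec; yes; no)
open import Relation.Binary.PropositionalEquality
  using (_≡_; _≢_; refl; sym; trans; cong; cong₂; subst; module ≡-Reasoning)
open import Function.Bundles using (_⇔_; mk⇔; Inverse; Equivalence)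
open import Data.Fin.Properties using (any?)

module NMAlgebraProperties (A : NMSig) (nm : IsNMAlgebra A) where
  open NMSig A
  open IsNMAlgebra nm

  residual-intro : ∀ {x y z} → x ⊙ y ≤ z → x ≤ (y ⇒ z)
  residual-intro {x} {y} {z} = Equivalence.to (residuation x y z)

  residual-elim : ∀ {x y z} → x ≤ (y ⇒ z) → x ⊙ y ≤ z
  residual-elim {x} {y} {z} = Equivalence.from (residuation x y z)

  ∧-idem : ∀ x → x ∧ x ≡ x
  ∧-idem x = trans (cong (x ∧_) (sym (∨-absorb x x))) (∧-absorb x (x ∧ x))

  ≤-refl : ∀ {x} → x ≤ x
  ≤-refl {x} = ∧-idem x

  ≤-reflexive : ∀ {x y} → x ≡ y → x ≤ y
  ≤-reflexive refl = ≤-refl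

  ≤-trans : ∀ {x y z} → x ≤ y → y ≤ z → x ≤ z
  ≤-trans {x} {y} {z} x≤y y≤z = begin
    x ∧ z         ≡⟨ cong (_∧ z) (sym x≤y) ⟩
    (x ∧ y) ∧ z   ≡⟨ ∧-assoc x y z ⟩
    x ∧ (y ∧ z)   ≡⟨ cong (x ∧_) y≤z ⟩
    x ∧ y         ≡⟨ x≤y ⟩
    x             ∎
    where open ≡-Reasoning

  ≤-antisym : ∀ {x y} → x ≤ y → y ≤ x → x ≡ y
  ≤-antisym {x} {y} x≤y y≤x = trans (sym x≤y) (trans (∧-comm x y) y≤x)

  x∧y≤x : ∀ {x y} → x ∧ y ≤ x
  x∧y≤x {x} {y} = begin
    (x ∧ y) ∧ x   ≡⟨ ∧-assoc x y x ⟩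
    x ∧ (y ∧ x)   ≡⟨ cong (x ∧_) (∧-comm y x) ⟩
    x ∧ (x ∧ y)   ≡⟨ sym (∧-assoc x x y) ⟩
    (x ∧ x) ∧ y   ≡⟨ cong (_∧ y) (∧-idem x) ⟩
    x ∧ y         ∎
    where open ≡-Reasoning

  x∧y≤y : ∀ {x y} → x ∧ y ≤ y
  x∧y≤y {x} {y} = trans (∧-assoc x y y) (cong (x ∧_) (∧-idem y))

  ∧-greatest : ∀ {x y z} → z ≤ x → z ≤ y → z ≤ x ∧ y
  ∧-greatest {x} {y} {z} z≤x z≤y = trans (sym (∧-assoc z x y)) (trans (cong (_∧ y) z≤x) z≤y)

  x≤x∨y : ∀ {x y} → x ≤ x ∨ y
  x≤x∨y {x} {y} = ∧-absorb x y

  y≤x∨y : ∀ {x y} → y ≤ x ∨ y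
  y≤x∨y {x} {y} = trans (cong (y ∧_) (∨-comm x y)) (∧-absorb y x)

  ≤⇒∨≡ : ∀ {x y} → x ≤ y → x ∨ y ≡ y
  ≤⇒∨≡ {x} {y} x≤y = begin
    x ∨ y         ≡⟨ cong (_∨ y) (sym x≤y) ⟩
    (x ∧ y) ∨ y   ≡⟨ ∨-comm (x ∧ y) y ⟩
    y ∨ (x ∧ y)   ≡⟨ cong (y ∨_) (∧-comm x y) ⟩
    y ∨ (y ∧ x)   ≡⟨ ∨-absorb y x ⟩
    y             ∎
    where open ≡-Reasoning

  ∨≡⇒≤ : ∀ {x y} → x ∨ y ≡ y → x ≤ y
  ∨≡⇒≤ {x} {y} x∨y≡y = trans (cong (x ∧_) (sym x∨y≡y)) (∧-absorb x y)

  ∨-least : ∀ {x y z} → x ≤ z → y ≤ z → x ∨ y ≤ z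
  ∨-least {x} {y} {z} x≤z y≤z =
    ∨≡⇒≤ (trans (∨-assoc x y z) (trans (cong (x ∨_) (≤⇒∨≡ y≤z)) (≤⇒∨≡ x≤z)))

  ⊥≤x : ∀ {x} → bot ≤ x
  ⊥≤x {x} = bot-least x

  x≤⊤ : ∀ {x} → x ≤ top
  x≤⊤ {x} = top-greatest x

  ⊙-monoˡ : ∀ {x y z} → x ≤ y → x ⊙ z ≤ y ⊙ z
  ⊙-monoˡ x≤y = residual-elim (≤-trans x≤y (residual-intro ≤-refl))

  ⊙-monoʳ : ∀ {x y z} → x ≤ y → z ⊙ x ≤ z ⊙ y
  ⊙-monoʳ {x} {y} {z} x≤y rewrite ⊙-comm z x | ⊙-comm z y = ⊙-monoˡ x≤y

  ⊙-mono : ∀ {a b c d} → a ≤ b → c ≤ d → a ⊙ c ≤ b ⊙ d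
  ⊙-mono a≤b c≤d = ≤-trans (⊙-monoˡ a≤b) (⊙-monoʳ c≤d)

  x⊙y≤x : ∀ {x y} → x ⊙ y ≤ x
  x⊙y≤x {x} {y} = ≤-trans (⊙-monoʳ x≤⊤) (≤-reflexive (⊙-identity x))

  x⊙y≤y : ∀ {x y} → x ⊙ y ≤ y
  x⊙y≤y {x} {y} rewrite ⊙-comm x y = x⊙y≤x

  x⊙y≤x∧y : ∀ {x y} → x ⊙ y ≤ x ∧ y
  x⊙y≤x∧y = ∧-greatest x⊙y≤x x⊙y≤y

  modus-ponens : ∀ {x y} → (x ⇒ y) ⊙ x ≤ y
  modus-ponens = residual-elim ≤-refl

  modus-ponens′ : ∀ {x y} → x ⊙ (x ⇒ y) ≤ y
  modus-ponens′ {x} {y} rewrite ⊙-comm x (x ⇒ y) = modus-ponens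

  ⇒-monoʳ : ∀ {x y y′} → y ≤ y′ → (x ⇒ y) ≤ (x ⇒ y′)
  ⇒-monoʳ y≤y′ = residual-intro (≤-trans modus-ponens y≤y′)

  ⇒-antiˡ : ∀ {x x′ y} → x′ ≤ x → (x ⇒ y) ≤ (x′ ⇒ y)
  ⇒-antiˡ x′≤x = residual-intro (≤-trans (⊙-monoʳ x′≤x) modus-ponens)

  y≤x⇒y : ∀ {x y} → y ≤ (x ⇒ y)
  y≤x⇒y = residual-intro x⊙y≤x

  ¬x≤x⇒y : ∀ {x y} → ¬' x ≤ (x ⇒ y)
  ¬x≤x⇒y = residual-intro (≤-trans modus-ponens ⊥≤x)

  ⇒-refl : ∀ {x} → (x ⇒ x) ≡ top
  ⇒-refl {x} = ≤-antisym x≤⊤ (residual-intro (≤-reflexive (trans (⊙-comm top x) (⊙-identity x))))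

  ⊙-swapʳ : ∀ a b c → (a ⊙ b) ⊙ c ≡ (a ⊙ c) ⊙ b
  ⊙-swapʳ a b c = trans (⊙-assoc a b c) (trans (cong (a ⊙_) (⊙-comm b c)) (sym (⊙-assoc a c b)))

  ⊙-interchange : ∀ a b c d → (a ⊙ b) ⊙ (c ⊙ d) ≡ (a ⊙ c) ⊙ (b ⊙ d)
  ⊙-interchange a b c d = begin
    (a ⊙ b) ⊙ (c ⊙ d)   ≡⟨ sym (⊙-assoc (a ⊙ b) c d) ⟩
    ((a ⊙ b) ⊙ c) ⊙ d   ≡⟨ cong (_⊙ d) (⊙-swapʳ a b c) ⟩
    ((a ⊙ c) ⊙ b) ⊙ d   ≡⟨ ⊙-assoc (a ⊙ c) b d ⟩
    (a ⊙ c) ⊙ (b ⊙ d)   ∎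
    where open ≡-Reasoning

  ⇒-compose : ∀ {a b c} → (a ⇒ b) ⊙ (b ⇒ c) ≤ (a ⇒ c)
  ⇒-compose {a} {b} {c} = residual-intro (≤-trans (≤-reflexive (⊙-swapʳ (a ⇒ b) (b ⇒ c) a))
    (≤-trans (⊙-monoˡ modus-ponens) modus-ponens′))

  ⊙-distribʳ-∨ : ∀ {x y z} → (x ∨ y) ⊙ z ≤ (x ⊙ z) ∨ (y ⊙ z)
  ⊙-distribʳ-∨ = residual-elim (∨-least (residual-intro x≤x∨y) (residual-intro y≤x∨y))

  -- Proof by cases: if a ∨ b = ⊤ then s ≤ t follows from s ⊙ a ≤ t and
  -- s ⊙ b ≤ t.  This is how prelinearity and WNM are put to use.
  by-cases : ∀ {a b s t} → a ∨ b ≡ top → s ⊙ a ≤ t → s ⊙ b ≤ t → s ≤ t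
  by-cases {a} {b} {s} {t} a∨b≡⊤ sa≤t sb≤t =
    ≤-trans (≤-reflexive s≡[a∨b]⊙s)
      (≤-trans ⊙-distribʳ-∨ (∨-least (≤-trans (≤-reflexive (⊙-comm a s)) sa≤t)
                                       (≤-trans (≤-reflexive (⊙-comm b s)) sb≤t)))
    where
    s≡[a∨b]⊙s : s ≡ (a ∨ b) ⊙ s
    s≡[a∨b]⊙s = trans (sym (⊙-identity s)) (trans (cong (s ⊙_) (sym a∨b≡⊤)) (⊙-comm s (a ∨ b)))

  -- WNM with x = y says x² ≤ x³; hence squares are idempotent.
  square≤cube : ∀ z → z ⊙ z ≤ z ⊙ (z ⊙ z)
  square≤cube z = by-cases (wnm z z)
    (≤-trans modus-ponens′ ⊥≤x)
    (≤-trans (≤-reflexive (⊙-assoc z z _))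
      (⊙-monoʳ (≤-trans (⊙-monoʳ (⇒-antiˡ (≤-reflexive (sym (∧-idem z))))) modus-ponens′)))

  square-idempotent : ∀ z → z ⊙ z ≤ (z ⊙ z) ⊙ (z ⊙ z)
  square-idempotent z = ≤-trans (square≤cube z)
    (≤-trans (⊙-monoʳ (square≤cube z)) (≤-reflexive (sym (⊙-assoc z z (z ⊙ z)))))

  -- Prelinearity makes implication distribute over joins in its consequent.
  ⇒-distrib-∨ : ∀ {x y z} → (x ⇒ (y ∨ z)) ≤ ((x ⇒ y) ∨ (x ⇒ z))
  ⇒-distrib-∨ {x} {y} {z} = by-cases (prelinear y z)
    (≤-trans (residual-intro (≤-trans (≤-reflexive (⊙-swapʳ _ (y ⇒ z) x))
       (≤-trans (⊙-monoˡ modus-ponens) (≤-trans ⊙-distribʳ-∨ (∨-least modus-ponens′ x⊙y≤x))))) y≤x∨y)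
    (≤-trans (residual-intro (≤-trans (≤-reflexive (⊙-swapʳ _ (z ⇒ y) x))
       (≤-trans (⊙-monoˡ modus-ponens) (≤-trans ⊙-distribʳ-∨ (∨-least x⊙y≤x modus-ponens′))))) x≤x∨y)

  ¬[x⊙y]≤x⇒¬y : ∀ {x y} → ¬' (x ⊙ y) ≤ (x ⇒ ¬' y)
  ¬[x⊙y]≤x⇒¬y {x} {y} = residual-intro (residual-intro (≤-trans (≤-reflexive (⊙-assoc _ x y)) modus-ponens))

  ¬[x⊙y]≤y⇒¬x : ∀ {x y} → ¬' (x ⊙ y) ≤ (y ⇒ ¬' x)
  ¬[x⊙y]≤y⇒¬x {x} {y} = ≤-trans (≤-reflexive (cong ¬' (⊙-comm x y))) ¬[x⊙y]≤x⇒¬y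

  x⇒¬y≤¬[x⊙y] : ∀ {x y} → (x ⇒ ¬' y) ≤ ¬' (x ⊙ y)
  x⇒¬y≤¬[x⊙y] {x} {y} = residual-intro (≤-trans (≤-reflexive (sym (⊙-assoc _ x y)))
    (≤-trans (⊙-monoˡ modus-ponens) modus-ponens))

  contraposition : ∀ {x y} → (x ⇒ y) ≤ (¬' y ⇒ ¬' x)
  contraposition {x} {y} = residual-intro (residual-intro (≤-trans (≤-reflexive (⊙-swapʳ _ (¬' y) x))
    (≤-trans (⊙-monoˡ modus-ponens) modus-ponens′)))

  ¬[x⇒y]≤x : ∀ {x y} → ¬' (x ⇒ y) ≤ x
  ¬[x⇒y]≤x {x} {y} = ≤-trans (⇒-antiˡ ¬x≤x⇒y) (≤-reflexive (involutive x))

  ¬[x⇒y]≤¬y : ∀ {x y} → ¬' (x ⇒ y) ≤ ¬' y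
  ¬[x⇒y]≤¬y = ⇒-antiˡ y≤x⇒y

  x⊙¬y≤¬[x⇒y] : ∀ {x y} → x ⊙ ¬' y ≤ ¬' (x ⇒ y)
  x⊙¬y≤¬[x⇒y] {x} {y} = residual-intro (≤-trans (≤-reflexive (⊙-swapʳ x (¬' y) (x ⇒ y)))
    (≤-trans (⊙-monoˡ modus-ponens′) modus-ponens′))

  ¬[x∧y]≤¬x∨¬y : ∀ {x y} → ¬' (x ∧ y) ≤ (¬' x ∨ ¬' y)
  ¬[x∧y]≤¬x∨¬y {x} {y} = by-cases (prelinear x y)
    (≤-trans (residual-intro (≤-trans (≤-reflexive (⊙-assoc _ _ x))
        (≤-trans (⊙-monoʳ (≤-trans (≤-reflexive (⊙-comm _ x)) (∧-greatest x⊙y≤x modus-ponens′)))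
                 modus-ponens))) x≤x∨y)
    (≤-trans (residual-intro (≤-trans (≤-reflexive (⊙-assoc _ _ y))
        (≤-trans (⊙-monoʳ (≤-trans (≤-reflexive (⊙-comm _ y)) (∧-greatest modus-ponens′ x⊙y≤x)))
                 modus-ponens))) y≤x∨y)

  ¬x⊙¬y≤¬[x∨y] : ∀ {x y} → ¬' x ⊙ ¬' y ≤ ¬' (x ∨ y)
  ¬x⊙¬y≤¬[x∨y] {x} {y} = residual-intro (≤-trans (≤-reflexive (⊙-comm _ (x ∨ y)))
    (≤-trans ⊙-distribʳ-∨
      (∨-least (refutes x (¬' y))
               (≤-trans (⊙-monoʳ (≤-reflexive (⊙-comm _ _))) (refutes y (¬' x))))))
    where
    refutes : ∀ a b → a ⊙ (¬' a ⊙ b) ≤ bot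
    refutes a b = ≤-trans (≤-reflexive (sym (⊙-assoc a _ b))) (≤-trans (⊙-monoˡ modus-ponens′) (≤-trans x⊙y≤x ⊥≤x))

module PrimeFilterProperties (A : NMSig) (nm : IsNMAlgebra A)
    (p : NMSig.Carrier A → Set) (prime-filter : IsPrimeFilter A p) where
  open NMSig A
  open NMAlgebraProperties A nm
  open IsPrimeFilter prime-filter
  open IsFilter filter

  up : ∀ {x y} → p x → x ≤ y → p y
  up {x} {y} = upclosed x y

  p-⊙ : ∀ {x y} → p x → p y → p (x ⊙ y)
  p-⊙ {x} {y} = ⊙-closed x y

  p-⊤ : p top
  p-⊤ = up (proj₂ nonempty) x≤⊤

  p-≡⊤ : ∀ {x} → x ≡ top → p x
  p-≡⊤ x≡⊤ = subst p (sym x≡⊤) p-⊤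

  p-⊥ : ¬ p bot
  p-⊥ p-bot = proj₂ proper (up p-bot ⊥≤x)

  p-mp : ∀ {x y} → p x → p (x ⇒ y) → p y
  p-mp px px⇒y = up (p-⊙ px⇒y px) modus-ponens

  p-⇒-trans : ∀ {x y z} → p (x ⇒ y) → p (y ⇒ z) → p (x ⇒ z)
  p-⇒-trans px⇒y py⇒z = up (p-⊙ px⇒y py⇒z) ⇒-compose

  p-consistent : ∀ {x} → p x → ¬ p (¬' x)
  p-consistent px p¬x = p-⊥ (p-mp px p¬x)

  p-excluded : ∀ {x} → p (¬' x) → ¬ p x
  p-excluded p¬x px = p-consistent px p¬x

  p-∨ : ∀ {x y} → p (x ∨ y) → p x ⊎ p y
  p-∨ {x} {y} = prime x y

  p-∨-neither : ∀ {x y} → ¬ p x → ¬ p y → ¬ p (x ∨ y)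
  p-∨-neither x∉p y∉p pxy = [ x∉p , y∉p ] (p-∨ pxy)

  p¬-down : ∀ {x y} → p (¬' y) → x ≤ y → p (¬' x)
  p¬-down p¬y x≤y = up p¬y (⇒-antiˡ x≤y)

  extension-by-idempotent : ∀ e → e ≤ e ⊙ e → ¬ p (¬' e) → IsPrimeFilter A (λ y → p (e ⇒ y))
  extension-by-idempotent e e≤e⊙e p¬e∉ = record
    { filter = record
      { nonempty = top , up p-⊤ y≤x⇒y
      ; upclosed = λ a b pa a≤b → up pa (⇒-monoʳ a≤b)
      ; ⊙-closed = λ a b pa pb → up (p-⊙ pa pb) ⊙-closed-step
      }
    ; proper = bot , p¬e∉
    ; prime = λ a b pab → prime (e ⇒ a) (e ⇒ b) (up pab ⇒-distrib-∨)
    }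
    where
    ⊙-closed-step : ∀ {a b} → (e ⇒ a) ⊙ (e ⇒ b) ≤ (e ⇒ a ⊙ b)
    ⊙-closed-step {a} {b} = residual-intro (≤-trans (⊙-monoʳ e≤e⊙e)
      (≤-trans (≤-reflexive (⊙-interchange (e ⇒ a) (e ⇒ b) e e)) (⊙-mono modus-ponens modus-ponens)))

module ChainFacts where
  open Chain3 using (min; max; mul; imp)

  imp₃-refl : ∀ a → imp a a ≡ i₃
  imp₃-refl o₃ = refl
  imp₃-refl h₃ = refl
  imp₃-refl i₃ = refl

  imp₃-antisym : ∀ a b → imp a b ≡ i₃ → imp b a ≡ i₃ → a ≡ b
  imp₃-antisym o₃ o₃ _ _ = refl
  imp₃-antisym o₃ h₃ _ ()
  imp₃-antisym o₃ i₃ _ ()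
  imp₃-antisym h₃ o₃ () _
  imp₃-antisym h₃ h₃ _ _ = refl
  imp₃-antisym h₃ i₃ _ ()
  imp₃-antisym i₃ o₃ () _
  imp₃-antisym i₃ h₃ () _
  imp₃-antisym i₃ i₃ _ _ = refl

  embed : Two → Three
  embed o₂ = o₃
  embed i₂ = i₃

  collapse : Three → Two
  collapse i₃ = i₂
  collapse _  = o₂

  collapse-embed : ∀ a → collapse (embed a) ≡ a
  collapse-embed o₂ = refl
  collapse-embed i₂ = refl

  embed-collapse : ∀ a → a ≢ h₃ → embed (collapse a) ≡ a
  embed-collapse o₃ _ = refl
  embed-collapse h₃ a≢½ = ⊥-elim (a≢½ refl)
  embed-collapse i₃ _ = refl

  embed-min : ∀ a b → min (embed a) (embed b) ≡ embed (Chain2.min a b)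
  embed-min o₂ _ = refl
  embed-min i₂ _ = refl

  embed-max : ∀ a b → max (embed a) (embed b) ≡ embed (Chain2.max a b)
  embed-max o₂ _ = refl
  embed-max i₂ o₂ = refl
  embed-max i₂ i₂ = refl

  embed-mul : ∀ a b → mul (embed a) (embed b) ≡ embed (Chain2.mul a b)
  embed-mul o₂ _  = refl
  embed-mul i₂ o₂ = refl
  embed-mul i₂ i₂ = refl

  embed-imp : ∀ a b → imp (embed a) (embed b) ≡ embed (Chain2.imp a b)
  embed-imp o₂ _  = refl
  embed-imp i₂ o₂ = refl
  embed-imp i₂ i₂ = refl

  collapse-op : ∀ (op₃ : Three → Three → Three) (op₂ : Two → Two → Two) →
    (∀ a b → op₃ (embed a) (embed b) ≡ embed (op₂ a b)) →
    ∀ a b → a ≢ h₃ → b ≢ h₃ → collapse (op₃ a b) ≡ op₂ (collapse a) (collapse b)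
  collapse-op op₃ op₂ embed-op a b a≢½ b≢½ = begin
    collapse (op₃ a b)
      ≡⟨ cong₂ (λ s t → collapse (op₃ s t)) (sym (embed-collapse a a≢½)) (sym (embed-collapse b b≢½)) ⟩
    collapse (op₃ (embed (collapse a)) (embed (collapse b)))
      ≡⟨ cong collapse (embed-op (collapse a) (collapse b)) ⟩
    collapse (embed (op₂ (collapse a) (collapse b)))
      ≡⟨ collapse-embed _ ⟩
    op₂ (collapse a) (collapse b) ∎
    where open ≡-Reasoning

module MaximalPrimeFilter (A : NMSig) (nm : IsNMAlgebra A)
    (p : NMSig.Carrier A → Set) (maximal-prime : IsMaximalPrimeFilter A p) where
  open NMSig A
  open IsNMAlgebra nm
  open NMAlgebraProperties A nm
  open IsMaximalPrimeFilter maximal-prime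
  open PrimeFilterProperties A nm p primeF
  open ChainFacts

  -- The two facts below are propositions whose proofs are never inspected;
  -- keeping them opaque stops the classification from unfolding them.
  opaque
    -- Maximality: if ¬ (z ⊙ z) ∉ p then z ∈ p, since the prime filter
    -- generated by p and the idempotent z ⊙ z must coincide with p.
    maximality : ∀ z → ¬ p (¬' (z ⊙ z)) → p z
    maximality z p¬e∉ = up (maximal extension (extension-by-idempotent e (square-idempotent z) p¬e∉)
                              (λ y py → up py y≤x⇒y) e (p-≡⊤ ⇒-refl))
                           x⊙y≤x
      where
      e : Carrier
      e = z ⊙ z
      extension : Carrier → Set
      extension y = p (e ⇒ y)

    -- Every x satisfies x ∈ p or ¬ (x ⊙ x) ∈ p (apply maximality to x ∨ ¬ x²).
    in-p-or-¬square : ∀ x → p x ⊎ p (¬' (x ⊙ x))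
    in-p-or-¬square x = p-∨ (maximality y p¬y²∉)
      where
      y : Carrier
      y = x ∨ ¬' (x ⊙ x)
      p¬y²∉ : ¬ p (¬' (y ⊙ y))
      p¬y²∉ p¬y² = y∉p (up (maximality x (λ p¬x² → y∉p (up p¬x² y≤x∨y))) x≤x∨y)
        where
        y∉p : ¬ p y
        y∉p py = p-consistent (p-⊙ py py) p¬y²

  p? : ∀ x → Dec (p x)
  p? x with in-p-or-¬square x
  ... | inj₁ px = yes px
  ... | inj₂ p¬x² = no (λ px → p-consistent (p-⊙ px px) p¬x²)

  x∉p⇒x⇒¬x : ∀ {x} → ¬ p x → p (x ⇒ ¬' x)
  x∉p⇒x⇒¬x {x} x∉p with in-p-or-¬square x
  ... | inj₁ px = ⊥-elim (x∉p px)
  ... | inj₂ p¬x² = up p¬x² ¬[x⊙y]≤x⇒¬y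

  Middle : Carrier → Set
  Middle x = ¬ p x × ¬ p (¬' x)

  data Class (x : Carrier) : Set where
    upper  : p x → Class x
    lower  : p (¬' x) → Class x
    middle : Middle x → Class x

  classify : ∀ x → Class x
  classify x with p? x | p? (¬' x)
  ... | yes px | _      = upper px
  ... | no _   | yes p¬x = lower p¬x
  ... | no x∉p | no ¬x∉p = middle (x∉p , ¬x∉p)

  middle-¬ : ∀ {x} → Middle x → Middle (¬' x)
  middle-¬ {x} (x∉p , ¬x∉p) = ¬x∉p , (λ p¬¬x → x∉p (subst p (involutive x) p¬¬x))

  -- Two middle elements are equivalent modulo p: by prelinearity and primeness
  -- one of x ⇒ y, y ⇒ x lies in p, and in the latter case
  -- x ⇒ ¬ x ⇒ ¬ y ⇒ y is a chain of implications in p.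
  middle⇒middle : ∀ {x y} → Middle x → Middle y → p (x ⇒ y)
  middle⇒middle {x} {y} (x∉p , _) (_ , ¬y∉p) with p-∨ (p-≡⊤ (prelinear x y))
  ... | inj₁ px⇒y = px⇒y
  ... | inj₂ py⇒x = p-⇒-trans (p-⇒-trans x⇒¬x ¬x⇒¬y) ¬y⇒y
    where
    x⇒¬x : p (x ⇒ ¬' x)
    x⇒¬x = x∉p⇒x⇒¬x x∉p
    ¬x⇒¬y : p (¬' x ⇒ ¬' y)
    ¬x⇒¬y = up py⇒x contraposition
    ¬y⇒y : p (¬' y ⇒ y)
    ¬y⇒y = subst (λ t → p (¬' y ⇒ t)) (involutive y) (x∉p⇒x⇒¬x ¬y∉p)

  classValue : ∀ {x} → Class x → Three
  classValue (upper _)  = i₃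
  classValue (lower _)  = o₃
  classValue (middle _) = h₃

  χ : Carrier → Three
  χ x = classValue (classify x)

  χ-upper : ∀ {x} → p x → χ x ≡ i₃
  χ-upper {x} px with classify x
  ... | upper _ = refl
  ... | lower p¬x = ⊥-elim (p-consistent px p¬x)
  ... | middle (x∉p , _) = ⊥-elim (x∉p px)

  χ-lower : ∀ {x} → p (¬' x) → χ x ≡ o₃
  χ-lower {x} p¬x with classify x
  ... | upper px = ⊥-elim (p-consistent px p¬x)
  ... | lower _ = refl
  ... | middle (_ , ¬x∉p) = ⊥-elim (¬x∉p p¬x)

  χ-middle : ∀ {x} → Middle x → χ x ≡ h₃
  χ-middle {x} (x∉p , ¬x∉p) with classify x
  ... | upper px = ⊥-elim (x∉p px)
  ... | lower p¬x = ⊥-elim (¬x∉p p¬x)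
  ... | middle _ = refl

  χ≡1⇒p : ∀ {x} → χ x ≡ i₃ → p x
  χ≡1⇒p {x} with classify x
  ... | upper px = λ _ → px
  ... | lower _ = λ ()
  ... | middle _ = λ ()

  χ≡½⇒middle : ∀ {x} → χ x ≡ h₃ → Middle x
  χ≡½⇒middle {x} with classify x
  ... | upper _ = λ ()
  ... | lower _ = λ ()
  ... | middle m = λ _ → m

  middle? : ∀ x → Dec (Middle x)
  middle? x with classify x
  ... | upper px = no (λ (x∉p , _) → x∉p px)
  ... | lower p¬x = no (λ (_ , ¬x∉p) → ¬x∉p p¬x)
  ... | middle m = yes m

  χ-∧ : ∀ x y → χ (x ∧ y) ≡ Chain3.min (χ x) (χ y)
  χ-∧ x y with classify x | classify y
  ... | upper px | upper py = χ-upper (up (p-⊙ px py) x⊙y≤x∧y)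
  ... | upper _  | lower p¬y = χ-lower (p¬-down p¬y x∧y≤y)
  ... | upper px | middle (y∉p , ¬y∉p) =
    χ-middle ((λ pxy → y∉p (up pxy x∧y≤y)) , λ p¬xy → p-∨-neither (p-consistent px) ¬y∉p (up p¬xy ¬[x∧y]≤¬x∨¬y))
  ... | lower p¬x | _ = χ-lower (p¬-down p¬x x∧y≤x)
  ... | middle (x∉p , ¬x∉p) | upper py =
    χ-middle ((λ pxy → x∉p (up pxy x∧y≤x)) , λ p¬xy → p-∨-neither ¬x∉p (p-consistent py) (up p¬xy ¬[x∧y]≤¬x∨¬y))
  ... | middle _ | lower p¬y = χ-lower (p¬-down p¬y x∧y≤y)
  ... | middle (x∉p , ¬x∉p) | middle (_ , ¬y∉p) =
    χ-middle ((λ pxy → x∉p (up pxy x∧y≤x)) , λ p¬xy → p-∨-neither ¬x∉p ¬y∉p (up p¬xy ¬[x∧y]≤¬x∨¬y))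

  χ-∨ : ∀ x y → χ (x ∨ y) ≡ Chain3.max (χ x) (χ y)
  χ-∨ x y with classify x | classify y
  ... | upper px | _ = χ-upper (up px x≤x∨y)
  ... | lower _ | upper py = χ-upper (up py y≤x∨y)
  ... | lower p¬x | lower p¬y = χ-lower (up (p-⊙ p¬x p¬y) ¬x⊙¬y≤¬[x∨y])
  ... | lower p¬x | middle (y∉p , ¬y∉p) =
    χ-middle (p-∨-neither (p-excluded p¬x) y∉p , λ p¬xy → ¬y∉p (p¬-down p¬xy y≤x∨y))
  ... | middle _ | upper py = χ-upper (up py y≤x∨y)
  ... | middle (x∉p , ¬x∉p) | lower p¬y =
    χ-middle (p-∨-neither x∉p (p-excluded p¬y) , λ p¬xy → ¬x∉p (p¬-down p¬xy x≤x∨y))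
  ... | middle (x∉p , ¬x∉p) | middle (y∉p , _) =
    χ-middle (p-∨-neither x∉p y∉p , λ p¬xy → ¬x∉p (p¬-down p¬xy x≤x∨y))

  χ-⊙ : ∀ x y → χ (x ⊙ y) ≡ Chain3.mul (χ x) (χ y)
  χ-⊙ x y with classify x | classify y
  ... | upper px | upper py = χ-upper (p-⊙ px py)
  ... | upper _ | lower p¬y = χ-lower (p¬-down p¬y x⊙y≤y)
  ... | upper px | middle (y∉p , ¬y∉p) =
    χ-middle ((λ pxy → y∉p (up pxy x⊙y≤y)) , λ p¬xy → ¬y∉p (p-mp px (up p¬xy ¬[x⊙y]≤x⇒¬y)))
  ... | lower p¬x | _ = χ-lower (p¬-down p¬x x⊙y≤x)
  ... | middle (x∉p , ¬x∉p) | upper py =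
    χ-middle ((λ pxy → x∉p (up pxy x⊙y≤x)) , λ p¬xy → ¬x∉p (p-mp py (up p¬xy ¬[x⊙y]≤y⇒¬x)))
  ... | middle _ | lower p¬y = χ-lower (p¬-down p¬y x⊙y≤y)
  ... | middle mx | middle my = χ-lower (up (middle⇒middle mx (middle-¬ my)) x⇒¬y≤¬[x⊙y])

  χ-⇒ : ∀ x y → χ (x ⇒ y) ≡ Chain3.imp (χ x) (χ y)
  χ-⇒ x y with classify x | classify y
  ... | lower p¬x | _ = χ-upper (up p¬x ¬x≤x⇒y)
  ... | upper _ | upper py = χ-upper (up py y≤x⇒y)
  ... | upper px | lower p¬y = χ-lower (up (p-⊙ px p¬y) x⊙¬y≤¬[x⇒y])
  ... | upper px | middle (y∉p , ¬y∉p) =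
    χ-middle ((λ px⇒y → y∉p (p-mp px px⇒y)) , λ p¬xy → ¬y∉p (up p¬xy ¬[x⇒y]≤¬y))
  ... | middle _ | upper py = χ-upper (up py y≤x⇒y)
  ... | middle (x∉p , ¬x∉p) | lower p¬y =
    χ-middle ((λ px⇒y → ¬x∉p (p-mp p¬y (up px⇒y contraposition))) , λ p¬xy → x∉p (up p¬xy ¬[x⇒y]≤x))
  ... | middle mx | middle my = χ-upper (middle⇒middle mx my)

  χ-⊥ : χ bot ≡ o₃
  χ-⊥ = χ-lower (p-≡⊤ ⇒-refl)

  χ-⊤ : χ top ≡ i₃
  χ-⊤ = χ-upper p-⊤

  -- The kernel of χ is the congruence of p: x ⇒ y ∈ p iff χ x ≤ χ y in 𝟑.
  χ-kernel : ∀ x y → (χ x ≡ χ y) ⇔ p ((x ⇒ y) ⊙ (y ⇒ x))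
  χ-kernel x y = mk⇔ (λ χx≡χy → p-⊙ (⇒-in-p χx≡χy) (⇒-in-p (sym χx≡χy)))
                     (λ q → imp₃-antisym (χ x) (χ y) (χ-imp-top (up q x⊙y≤x)) (χ-imp-top (up q x⊙y≤y)))
    where
    ⇒-in-p : ∀ {u v} → χ u ≡ χ v → p (u ⇒ v)
    ⇒-in-p {u} {v} χu≡χv = χ≡1⇒p (begin
      χ (u ⇒ v)                 ≡⟨ χ-⇒ u v ⟩
      Chain3.imp (χ u) (χ v)    ≡⟨ cong (Chain3.imp (χ u)) (sym χu≡χv) ⟩
      Chain3.imp (χ u) (χ u)    ≡⟨ imp₃-refl (χ u) ⟩
      i₃                        ∎)
      where open ≡-Reasoning
    χ-imp-top : ∀ {u v} → p (u ⇒ v) → Chain3.imp (χ u) (χ v) ≡ i₃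
    χ-imp-top {u} {v} pu⇒v = trans (sym (χ-⇒ u v)) (χ-upper pu⇒v)

  quotient≅𝟑 : ∃ Middle → QuotientIso A p 𝟑
  quotient≅𝟑 (m , middle-m) = record
    { f = χ ; kernel = χ-kernel ; surjective = onto
    ; pres-∧ = χ-∧ ; pres-∨ = χ-∨ ; pres-⊙ = χ-⊙ ; pres-⇒ = χ-⇒
    ; pres-bot = χ-⊥ ; pres-top = χ-⊤ }
    where
    onto : ∀ b → ∃ λ x → χ x ≡ b
    onto o₃ = bot , χ-⊥
    onto h₃ = m , χ-middle middle-m
    onto i₃ = top , χ-⊤

  quotient≅𝟐 : (∀ x → ¬ Middle x) → QuotientIso A p 𝟐
  quotient≅𝟐 no-middle = record
    { f = λ x → collapse (χ x)
    ; kernel = λ x y → mk⇔ (λ e → Equivalence.to (χ-kernel x y) (collapse-injective e))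
                           (λ q → cong collapse (Equivalence.from (χ-kernel x y) q))
    ; surjective = onto
    ; pres-∧ = collapsed Chain3.min Chain2.min embed-min χ-∧
    ; pres-∨ = collapsed Chain3.max Chain2.max embed-max χ-∨
    ; pres-⊙ = collapsed Chain3.mul Chain2.mul embed-mul χ-⊙
    ; pres-⇒ = collapsed Chain3.imp Chain2.imp embed-imp χ-⇒
    ; pres-bot = cong collapse χ-⊥
    ; pres-top = cong collapse χ-⊤ }
    where
    χ≢½ : ∀ x → χ x ≢ h₃
    χ≢½ x χx≡½ = no-middle x (χ≡½⇒middle χx≡½)

    collapse-injective : ∀ {x y} → collapse (χ x) ≡ collapse (χ y) → χ x ≡ χ y
    collapse-injective {x} {y} e =
      trans (sym (embed-collapse (χ x) (χ≢½ x))) (trans (cong embed e) (embed-collapse (χ y) (χ≢½ y)))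

    collapsed : ∀ (op₃ : Three → Three → Three) (op₂ : Two → Two → Two) {_∙_ : Carrier → Carrier → Carrier} →
      (∀ a b → op₃ (embed a) (embed b) ≡ embed (op₂ a b)) →
      (∀ x y → χ (x ∙ y) ≡ op₃ (χ x) (χ y)) →
      ∀ x y → collapse (χ (x ∙ y)) ≡ op₂ (collapse (χ x)) (collapse (χ y))
    collapsed op₃ op₂ embed-op χ-op x y =
      trans (cong collapse (χ-op x y)) (collapse-op op₃ op₂ embed-op (χ x) (χ y) (χ≢½ x) (χ≢½ y))

    onto : ∀ b → ∃ λ x → collapse (χ x) ≡ b
    onto o₂ = bot , cong collapse χ-⊥
    onto i₂ = top , cong collapse χ-⊤

finite-search : ∀ {X : Set} → Finite X → {P : X → Set} → (∀ x → Dec (P x)) → ∃ P ⊎ (∀ x → ¬ P x)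
finite-search (n , X↔Fin) {P} P? with any? (λ i → P? (Inverse.from X↔Fin i))
... | yes (i , Pi) = inj₁ (Inverse.from X↔Fin i , Pi)
... | no none = inj₂ (λ x Px → none (Inverse.to X↔Fin x ,
                        subst P (sym (Inverse.strictlyInverseʳ X↔Fin x)) Px))

lemma1 : (A : NMSig) → IsNMAlgebra A → Finite (NMSig.Carrier A) →
    (p : NMSig.Carrier A → Set) → IsMaximalPrimeFilter A p →
    QuotientIso A p 𝟐 ⊎ QuotientIso A p 𝟑
lemma1 A nm finite p maximal-prime =
  [ (λ some-middle → inj₂ (quotient≅𝟑 some-middle)) , (λ no-middle → inj₁ (quotient≅𝟐 no-middle)) ]
    (finite-search finite middle?)
  where open MaximalPrimeFilter A nm p maximal-prime
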